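{- Let $n\ge3$ and $2^{n-3}<k\le 2^{n-2}$. Let $H_1,\dots,H_{h(n,k)}$ be representatives of the equivalence classes (under $B_n$) of spanned hyperplanes of $Q_n$ containing at least $k$ points of $V_n$, and for each $i$ let $A_i$ be the set of $0/1$-equivalence classes of $Q_n$ that contain some class of $\mathcal{P}(H_i,k)$. Fix $1\le i<j\le h(n,k)$, and let $H_i\cap w_1(H_j),\dots,H_i\cap w_m(H_j)$ be representatives of the equivalence classes (under $B_n$) of $E(H_i,H_j,k)$. Define $\Phi_3$ on the disjoint union $\bigsqcup_{s=1}^m\mathcal{P}(H_i\cap w_s(H_j),k)$ by sending a partial $0/1$-equivalence class to the unique $0/1$-equivalence class of $Q_n$ containing it. Then $\Phi_3$ is a bijection from this disjoint union onto $A_i\cap A_j$.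
   Context: $Q_n=[0,1]^n$, $V_n=\{0,1\}^n$. A $0/1$-polytope of $Q_n$ is the convex hull of a nonempty subset of $V_n$; it has $k$ vertices if the subset has $k$ elements. $B_n$ is the group of signed permutations $w$ of $\{1,\dots,n\}$ (underlying permutation $\pi$, sign $\pm$ on each $i$) acting on $\mathbb{R}^n$ by $w(x)_i=x_{\pi(i)}$ (sign $+$) or $1-x_{\pi(i)}$ (sign $-$), and on subsets by taking images; two subsets (polytopes, hyperplanes, intersections) are equivalent under $B_n$ if some $w\in B_n$ maps one onto the other, and $0/1$-equivalence classes of $Q_n$ are the classes of $0/1$-polytopes under this relation. A spanned hyperplane of $Q_n$ is a hyperplane $H$ such that the affine hull of $H\cap V_n$ is $H$. For $\mathcal S\subset\mathbb{R}^n$, the partial $0/1$-equivalence classes of $\mathcal S$ are the classes of $0/1$-polytopes contained in $\mathcal S$ under $P\sim P'$ iff $g(P)=P'$ for some $g\in B_n$, and $\mathcal{P}(\mathcal S,k)$ is the set of those with $k$ vertices. $E(H_i,H_j,k)$ is the set of intersections $H_i\cap w(H_j)$, $w\in B_n$, containing at least $k$ points of $V_n$.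
   Formalization: The ambient space is ℚ^n rather than $\mathbb{R}^n$, so points have rational coordinates and hyperplanes, affine hulls and convex hulls are taken with rational coefficients. -}

module Defs where

open import Data.Nat using (ℕ; zero; suc)
open import Data.Fin using (Fin; zero; suc)
open import Data.Fin.Permutation using (Permutation′; _⟨$⟩ʳ_)
open import Data.Bool using (Bool; true; false; if_then_else_)
open import Data.Vec using (Vec; lookup)
open import Data.List using (List; []; _∷_; length)
open import Data.List.Relation.Unary.All using (All)
open import Data.List.Relation.Unary.Unique.Propositional using (Unique)
open import Data.List.Membership.Propositional using (_∈_)
open import Data.Rational using (ℚ; 0ℚ; 1ℚ; _+_; _*_; _-_; _≤_)
open import Data.Product using (Σ; ∃; _×_; _,_; proj₁; proj₂)
open import Relation.Binary.PropositionalEquality using (_≡_; _≢_)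
open import Relation.Nullary using (¬_)
open import Level using (0ℓ) renaming (suc to lsuc)

Point : ℕ → Set
Point n = Fin n → ℚ

_≈ₚ_ : ∀ {n} → Point n → Point n → Set
x ≈ₚ y = ∀ i → x i ≡ y i

PSet : ℕ → Set₁
PSet n = Point n → Set

_≐_ : ∀ {n} → PSet n → PSet n → Set
A ≐ B = ∀ x → (A x → B x) × (B x → A x)

_⊆ₛ_ : ∀ {n} → PSet n → PSet n → Set
A ⊆ₛ B = ∀ x → A x → B x

_∩ₛ_ : ∀ {n} → PSet n → PSet n → PSet n
(A ∩ₛ B) x = A x × B x

∑ : ∀ {n} → (Fin n → ℚ) → ℚ
∑ {zero} f = 0ℚ
∑ {suc n} f = f zero + ∑ (λ i → f (suc i))

Vertex : ℕ → Set
Vertex n = Vec Bool n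

embed : ∀ {n} → Vertex n → Point n
embed v i = if lookup v i then 1ℚ else 0ℚ

AtLeastVerts : ∀ {n} → ℕ → PSet n → Set
AtLeastVerts {n} k X =
  Σ (List (Vertex n)) λ L → Unique L × (k Data.Nat.≤ length L) × All (λ v → X (embed v)) L

weightSum : ∀ {n} → List (ℚ × Vertex n) → ℚ
weightSum [] = 0ℚ
weightSum ((c , _) ∷ cs) = c + weightSum cs

combo : ∀ {n} → List (ℚ × Vertex n) → Point n
combo [] i = 0ℚ
combo ((c , v) ∷ cs) i = c * embed v i + combo cs i

-- affine hull of the vertex set {v ∈ V_n | embed v ∈ X}
affHullV : ∀ {n} → PSet n → PSet n
affHullV {n} X x =
  Σ (List (ℚ × Vertex n)) λ cs →
    All (λ p → X (embed (proj₂ p))) cs × weightSum cs ≡ 1ℚ × combo cs ≈ₚ x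

convV : ∀ {n} → List (Vertex n) → PSet n
convV {n} U x =
  Σ (List (ℚ × Vertex n)) λ cs →
    All (λ p → (0ℚ ≤ proj₁ p) × (proj₂ p ∈ U)) cs × weightSum cs ≡ 1ℚ × combo cs ≈ₚ x

record Hyperplane (n : ℕ) : Set where
  field
    a    : Point n
    b    : ℚ
    a≢0  : Σ (Fin n) λ i → a i ≢ 0ℚ

⟦_⟧ : ∀ {n} → Hyperplane n → PSet n
⟦ H ⟧ x = ∑ (λ i → Hyperplane.a H i * x i) ≡ Hyperplane.b H

Spanned : ∀ {n} → Hyperplane n → Set
Spanned H = ⟦ H ⟧ ≐ affHullV ⟦ H ⟧

record SignedPerm (n : ℕ) : Set where
  field
    perm : Permutation′ n
    sign : Fin n → Bool      -- true = sign −

act : ∀ {n} → SignedPerm n → Point n → Point n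
act w x i = if SignedPerm.sign w i
              then 1ℚ - x (SignedPerm.perm w ⟨$⟩ʳ i)
              else x (SignedPerm.perm w ⟨$⟩ʳ i)

image : ∀ {n} → SignedPerm n → PSet n → PSet n
image w A y = Σ (Point _) λ x → A x × act w x ≈ₚ y

_≅B_ : ∀ {n} → PSet n → PSet n → Set
_≅B_ {n} A B = Σ (SignedPerm n) λ w → image w A ≐ B

-- 0/1-polytopes: convex hull of a nonempty set of vertices,
-- given by a duplicate-free list of its vertices

record Polytope01 (n : ℕ) : Set where
  field
    verts     : List (Vertex n)
    distinct  : Unique verts
    nonempty  : verts ≢ []

open Polytope01 public

polySet : ∀ {n} → Polytope01 n → PSet n
polySet P = convV (verts P)

numVerts : ∀ {n} → Polytope01 n → ℕ
numVerts P = length (verts P)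

_∼_ : ∀ {n} → Polytope01 n → Polytope01 n → Set
P ∼ Q = polySet P ≅B polySet Q

-- elements of 𝒫(S,k) before taking classes: 0/1-polytopes with k
-- vertices contained in S (the classes are taken w.r.t. _∼_)
PartialPoly : ∀ {n} → ℕ → PSet n → Set
PartialPoly {n} k S = Σ (Polytope01 n) λ P → numVerts P ≡ k × polySet P ⊆ₛ S

-- the 0/1-equivalence class of P belongs to A(H): it contains some
-- class of 𝒫(H,k)
InA : ∀ {n} → ℕ → Hyperplane n → Polytope01 n → Set
InA k H P = Σ (PartialPoly k ⟦ H ⟧) λ Q → proj₁ Q ∼ P

IsHypReps : (n k h : ℕ) → (Fin h → Hyperplane n) → Set
IsHypReps n k h H =
  (∀ i → Spanned (H i) × AtLeastVerts k ⟦ H i ⟧)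
  × (∀ i j → i ≢ j → ¬ (⟦ H i ⟧ ≅B ⟦ H j ⟧))
  × (∀ (G : Hyperplane n) → Spanned G → AtLeastVerts k ⟦ G ⟧ →
       Σ (Fin h) λ i → ⟦ G ⟧ ≅B ⟦ H i ⟧)

Inter : ∀ {n} → Hyperplane n → Hyperplane n → SignedPerm n → PSet n
Inter Hi Hj w = ⟦ Hi ⟧ ∩ₛ image w ⟦ Hj ⟧

IsEReps : (n k : ℕ) → Hyperplane n → Hyperplane n →
          (m : ℕ) → (Fin m → SignedPerm n) → Set
IsEReps n k Hi Hj m w =
  (∀ s → AtLeastVerts k (Inter Hi Hj (w s)))
  × (∀ s t → s ≢ t → ¬ (Inter Hi Hj (w s) ≅B Inter Hi Hj (w t)))
  × (∀ (u : SignedPerm n) → AtLeastVerts k (Inter Hi Hj u) →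
       Σ (Fin m) λ s → Inter Hi Hj u ≅B Inter Hi Hj (w s))

DisjUnion : ∀ {n} → ℕ → Hyperplane n → Hyperplane n →
            (m : ℕ) → (Fin m → SignedPerm n) → Set
DisjUnion k Hi Hj m w = Σ (Fin m) λ s → PartialPoly k (Inter Hi Hj (w s))

_≈⊔_ : ∀ {n k Hi Hj m w} → DisjUnion {n} k Hi Hj m w → DisjUnion k Hi Hj m w → Set
(s , P , _) ≈⊔ (t , Q , _) = (s ≡ t) × (P ∼ Q)

Φ₃ : ∀ {n k Hi Hj m w} → DisjUnion {n} k Hi Hj m w → Polytope01 n
Φ₃ (s , P , _) = P

-- f (between sets of classes, presented by representatives and the
-- class relations) is well defined, maps into T, and is a bijection onto T
IsBijectionOnto : {A B : Set} → (A → A → Set) → (B → B → Set) →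
                  (A → B) → (B → Set) → Set
IsBijectionOnto {A} {B} _≈A_ _≈B_ f T =
  (∀ {x y} → x ≈A y → f x ≈B f y)
  × (∀ x → T (f x))
  × (∀ {x y} → f x ≈B f y → x ≈A y)
  × (∀ y → T y → Σ A λ x → f x ≈B y)

{-# OPTIONS --safe #-}
module Submission where

-- Well-definedness is immediate, and Φ₃ lands in A_i ∩ A_j because P ⊆ H_i and w_s⁻¹(P) ⊆ H_j.
-- Onto: if Q ⊆ H_i and R ⊆ H_j are both equivalent to P, say h(R) = Q, then Q lies in H_i ∩ h(H_j),
-- which is equivalent to some representative H_i ∩ w_s(H_j). An affine subspace cut out by d independent equations contains at most
-- 2^(n-d) points of {0,1}^n (eliminate one coordinate per equation). As H_i and H_j are inequivalent,
-- H_i ∩ w_s(H_j) is a flat of codimension 2, and a polytope P with k > 2^(n-3) vertices on it satisfies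
-- no further affine equation: it affinely spans the flat. So if g(P) = Q ⊆ H_i ∩ w_t(H_j), then g maps
-- the first flat into the second and g⁻¹ maps it back, making the two representatives equivalent: s = t.

open import Defs
open SignedPerm
open import Data.Nat using (ℕ; _≤_; _<_; _^_; _∸_)
open import Data.Fin using (Fin) renaming (_<_ to _<ᶠ_)
open import Data.Product using (_×_)

open import Data.Nat as ℕ using (zero; suc; z≤n)
import Data.Nat.Properties as NP
open import Data.Fin using (zero; suc; punchIn; punchOut)
import Data.Fin.Properties as FP
import Data.Fin.Permutation as Perm
open import Data.Fin.Permutation using (Permutation′; _⟨$⟩ʳ_; _⟨$⟩ˡ_)
open import Data.Bool using (Bool; true; false; if_then_else_; _xor_)
open import Data.Vec using (lookup; tabulate; []; _∷_)
import Data.Vec.Properties as VP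
open import Data.List as L using (List; []; _∷_; length)
import Data.List.Properties as LP
open import Data.List.Relation.Unary.All as All using (All; []; _∷_)
import Data.List.Relation.Unary.All.Properties as AllP
import Data.List.Relation.Unary.Unique.Propositional.Properties as UniqueP
open import Data.List.Relation.Unary.Any using (Any; here; there)
open import Data.List.Relation.Unary.Unique.Propositional using (Unique)
open import Data.List.Relation.Unary.AllPairs using ([]; _∷_)
open import Data.List.Membership.Propositional using (_∈_)
import Data.List.Membership.Propositional.Properties as MP
open import Data.Rational as ℚ using (ℚ; 0ℚ; 1ℚ; _+_; _*_; _-_; -_; 1/_)
import Data.Rational.Properties as QP
open import Data.Rational.Solver using (module +-*-Solver)
open import Data.Product using (Σ; _,_; proj₁; proj₂)
open import Data.Sum using (_⊎_; inj₁; inj₂)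
open import Data.Empty using (⊥-elim)
open import Relation.Binary.PropositionalEquality
open import Relation.Nullary using (¬_; yes; no; does)
open import Relation.Nullary.Decidable using (dec-true; dec-false)
open import Function using (_∘_)
open import Algebra.Bundles using (CommutativeRing)
import Algebra.Properties.Group as GroupProperties
import Algebra.Properties.Semiring.Sum as SemiringSum

open +-*-Solver using (solve; _:+_; _:*_; _:-_; :-_; _:=_; con)
module ℚ-Group = GroupProperties QP.+-0-group
module ℚ-Sum = SemiringSum (CommutativeRing.semiring QP.+-*-commutativeRing)

*-cancelˡ-≡ : ∀ {p q r} → p ≢ 0ℚ → p * q ≡ p * r → q ≡ r
*-cancelˡ-≡ {p} {q} {r} p≢0 pq≡pr = begin
  q                   ≡⟨ sym (QP.*-identityˡ q) ⟩
  1ℚ * q              ≡⟨ cong (_* q) (sym (QP.*-inverseˡ p)) ⟩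
  (1/ p) * p * q      ≡⟨ QP.*-assoc (1/ p) p q ⟩
  (1/ p) * (p * q)    ≡⟨ cong ((1/ p) *_) pq≡pr ⟩
  (1/ p) * (p * r)    ≡⟨ sym (QP.*-assoc (1/ p) p r) ⟩
  (1/ p) * p * r      ≡⟨ cong (_* r) (QP.*-inverseˡ p) ⟩
  1ℚ * r              ≡⟨ QP.*-identityˡ r ⟩
  r                   ∎
  where open ≡-Reasoning
        instance _ = ℚ.≢-nonZero p≢0

p≢0∧p*q≡0⇒q≡0 : ∀ {p q} → p ≢ 0ℚ → p * q ≡ 0ℚ → q ≡ 0ℚ
p≢0∧p*q≡0⇒q≡0 {p} p≢0 pq≡0 = *-cancelˡ-≡ p≢0 (trans pq≡0 (sym (QP.*-zeroʳ p)))

p-q≡0⇒p≡q : ∀ p q → p - q ≡ 0ℚ → p ≡ q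
p-q≡0⇒p≡q = ℚ-Group.x∙y⁻¹≈ε⇒x≈y

p≡q⇒p-q≡0 : ∀ {p q} → p ≡ q → p - q ≡ 0ℚ
p≡q⇒p-q≡0 = ℚ-Group.x≈y⇒x∙y⁻¹≈ε

bit : Bool → ℚ
bit b = if b then 1ℚ else 0ℚ

bit-injective : ∀ {b c} → bit b ≡ bit c → b ≡ c
bit-injective {false} {false} _ = refl
bit-injective {false} {true}  e = ⊥-elim (QP.1≢0 (sym e))
bit-injective {true}  {false} e = ⊥-elim (QP.1≢0 e)
bit-injective {true}  {true}  _ = refl

embed-injective : ∀ {n} {u v : Vertex n} → embed u ≈ₚ embed v → u ≡ v
embed-injective {u = u} {v} eq = begin
  u                        ≡⟨ sym (VP.tabulate∘lookup u) ⟩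
  tabulate (lookup u)      ≡⟨ VP.tabulate-cong (bit-injective ∘ eq) ⟩
  tabulate (lookup v)      ≡⟨ VP.tabulate∘lookup v ⟩
  v                        ∎
  where open ≡-Reasoning

∑≡sum : ∀ {n} (f : Fin n → ℚ) → ∑ f ≡ ℚ-Sum.sum f
∑≡sum {zero}  f = refl
∑≡sum {suc n} f = cong (f zero +_) (∑≡sum (f ∘ suc))

∑-cong : ∀ {n} {f g : Fin n → ℚ} → (∀ i → f i ≡ g i) → ∑ f ≡ ∑ g
∑-cong {zero}  eq = refl
∑-cong {suc n} eq = cong₂ _+_ (eq zero) (∑-cong (eq ∘ suc))

∑-zero : ∀ {n} {f : Fin n → ℚ} → (∀ i → f i ≡ 0ℚ) → ∑ f ≡ 0ℚ
∑-zero {zero}  eq = refl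
∑-zero {suc n} eq = cong₂ _+_ (eq zero) (∑-zero (eq ∘ suc))

∑-distrib-+ : ∀ {n} (f g : Fin n → ℚ) → ∑ (λ i → f i + g i) ≡ ∑ f + ∑ g
∑-distrib-+ f g = begin
  ∑ (λ i → f i + g i)              ≡⟨ ∑≡sum (λ i → f i + g i) ⟩
  ℚ-Sum.sum (λ i → f i + g i)      ≡⟨ ℚ-Sum.∑-distrib-+ f g ⟩
  ℚ-Sum.sum f + ℚ-Sum.sum g        ≡⟨ sym (cong₂ _+_ (∑≡sum f) (∑≡sum g)) ⟩
  ∑ f + ∑ g                        ∎
  where open ≡-Reasoning

*-distribˡ-∑ : ∀ {n} c (f : Fin n → ℚ) → c * ∑ f ≡ ∑ (λ i → c * f i)
*-distribˡ-∑ c f = begin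
  c * ∑ f                     ≡⟨ cong (c *_) (∑≡sum f) ⟩
  c * ℚ-Sum.sum f             ≡⟨ ℚ-Sum.*-distribˡ-sum c f ⟩
  ℚ-Sum.sum (λ i → c * f i)   ≡⟨ sym (∑≡sum (λ i → c * f i)) ⟩
  ∑ (λ i → c * f i)           ∎
  where open ≡-Reasoning

∑-remove : ∀ {n} (p : Fin (suc n)) (f : Fin (suc n) → ℚ) → ∑ f ≡ f p + ∑ (f ∘ punchIn p)
∑-remove p f = begin
  ∑ f                                   ≡⟨ ∑≡sum f ⟩
  ℚ-Sum.sum f                           ≡⟨ ℚ-Sum.sum-remove {i = p} f ⟩
  f p + ℚ-Sum.sum (f ∘ punchIn p)      ≡⟨ cong (f p +_) (sym (∑≡sum (f ∘ punchIn p))) ⟩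
  f p + ∑ (f ∘ punchIn p)              ∎
  where open ≡-Reasoning

∑-permute : ∀ {n} (π : Permutation′ n) (f : Fin n → ℚ) → ∑ f ≡ ∑ (λ i → f (π ⟨$⟩ʳ i))
∑-permute π f = begin
  ∑ f                                   ≡⟨ ∑≡sum f ⟩
  ℚ-Sum.sum f                           ≡⟨ ℚ-Sum.sum-permute f π ⟩
  ℚ-Sum.sum (λ i → f (π ⟨$⟩ʳ i))        ≡⟨ sym (∑≡sum (λ i → f (π ⟨$⟩ʳ i))) ⟩
  ∑ (λ i → f (π ⟨$⟩ʳ i))                ∎
  where open ≡-Reasoning

-- Cube vertices on affine subspaces

record Affine (n : ℕ) : Set where
  constructor affine
  field
    coeff  : Fin n → ℚ
    offset : ℚ
open Affine public

eval : ∀ {n} → Affine n → Point n → ℚ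
eval f x = ∑ (λ i → coeff f i * x i) - offset f

Zeros : ∀ {n} → Affine n → PSet n
Zeros f x = eval f x ≡ 0ℚ

eval-cong : ∀ {n} (f : Affine n) {x y : Point n} → x ≈ₚ y → eval f x ≡ eval f y
eval-cong f x≈y = cong (_- offset f) (∑-cong (λ i → cong (coeff f i *_) (x≈y i)))

linComb : ∀ {n} → List ℚ → List (Affine n) → Point n → ℚ
linComb (c ∷ cs) (f ∷ F) x = c * eval f x + linComb cs F x
linComb _        _       x = 0ℚ

Dependent : ∀ {n} → List (Affine n) → Set
Dependent F = Σ (List ℚ) λ cs →
  length cs ≡ length F × Any (_≢ 0ℚ) cs × (∀ x → linComb cs F x ≡ 0ℚ)

CommonZero : ∀ {n} → List (Affine n) → Vertex n → Set
CommonZero F v = All (λ f → Zeros f (embed v)) F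

vanishing-constant⇒dependent : ∀ {n} (f : Affine n) (F : List (Affine n)) {y : Point n} →
  (∀ i → coeff f i ≡ 0ℚ) → Zeros f y → Dependent (f ∷ F)
vanishing-constant⇒dependent f F {y} f-const fy =
  1ℚ ∷ L.replicate (length F) 0ℚ , cong suc (LP.length-replicate (length F)) , here QP.1≢0 ,
  λ x → cong₂ _+_ (trans (QP.*-identityˡ (eval f x)) (trans (f≡-offset x) (trans (sym (f≡-offset y)) fy)))
                  (linComb-zeros F x)
  where
  f≡-offset : ∀ x → eval f x ≡ 0ℚ - offset f
  f≡-offset x = cong (_- offset f) (∑-zero (λ i → trans (cong (_* x i) (f-const i)) (QP.*-zeroˡ (x i))))
  linComb-zeros : ∀ G x → linComb (L.replicate (length G) 0ℚ) G x ≡ 0ℚ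
  linComb-zeros []      x = refl
  linComb-zeros (g ∷ G) x = cong₂ _+_ (QP.*-zeroˡ (eval g x)) (linComb-zeros G x)

unique-map⁺ : ∀ {A B : Set} {P : A → Set} (f : A → B) →
  (∀ {x y} → P x → P y → f x ≡ f y → x ≡ y) →
  ∀ {X} → All P X → Unique X → Unique (L.map f X)
unique-map⁺ f inj []         []           = []
unique-map⁺ f inj (px ∷ pX) (x∉X ∷ X!) =
  AllP.map⁺ (All.zipWith (λ (py , x≢y) fx≡fy → x≢y (inj px py fx≡fy)) (pX , x∉X))
  ∷ unique-map⁺ f inj pX X!

splitHead : ∀ {n} → List (Vertex (suc n)) → List (Vertex n) × List (Vertex n)
splitHead []                = [] , []
splitHead ((false ∷ v) ∷ X) = v ∷ proj₁ (splitHead X) , proj₂ (splitHead X)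
splitHead ((true  ∷ v) ∷ X) = proj₁ (splitHead X) , v ∷ proj₂ (splitHead X)

length-splitHead : ∀ {n} (X : List (Vertex (suc n))) →
  length X ≡ length (proj₁ (splitHead X)) ℕ.+ length (proj₂ (splitHead X))
length-splitHead []                = refl
length-splitHead ((false ∷ v) ∷ X) = cong suc (length-splitHead X)
length-splitHead ((true  ∷ v) ∷ X) = trans (cong suc (length-splitHead X)) (sym (NP.+-suc _ _))

splitHead-∈₀ : ∀ {n} (X : List (Vertex (suc n))) {w} → w ∈ proj₁ (splitHead X) → (false ∷ w) ∈ X
splitHead-∈₀ ((false ∷ v) ∷ X) (here refl) = here refl
splitHead-∈₀ ((false ∷ v) ∷ X) (there w∈)  = there (splitHead-∈₀ X w∈)
splitHead-∈₀ ((true  ∷ v) ∷ X) w∈          = there (splitHead-∈₀ X w∈)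

splitHead-∈₁ : ∀ {n} (X : List (Vertex (suc n))) {w} → w ∈ proj₂ (splitHead X) → (true ∷ w) ∈ X
splitHead-∈₁ ((true  ∷ v) ∷ X) (here refl) = here refl
splitHead-∈₁ ((true  ∷ v) ∷ X) (there w∈)  = there (splitHead-∈₁ X w∈)
splitHead-∈₁ ((false ∷ v) ∷ X) w∈          = there (splitHead-∈₁ X w∈)

splitHead-unique₀ : ∀ {n} (X : List (Vertex (suc n))) → Unique X → Unique (proj₁ (splitHead X))
splitHead-unique₀ []                _          = []
splitHead-unique₀ ((false ∷ v) ∷ X) (v∉X ∷ X!) =
  All.tabulate (λ w∈ v≡w → All.lookup v∉X (splitHead-∈₀ X w∈) (cong (false ∷_) v≡w))
  ∷ splitHead-unique₀ X X!
splitHead-unique₀ ((true  ∷ v) ∷ X) (_   ∷ X!) = splitHead-unique₀ X X!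

splitHead-unique₁ : ∀ {n} (X : List (Vertex (suc n))) → Unique X → Unique (proj₂ (splitHead X))
splitHead-unique₁ []                _          = []
splitHead-unique₁ ((true  ∷ v) ∷ X) (v∉X ∷ X!) =
  All.tabulate (λ w∈ v≡w → All.lookup v∉X (splitHead-∈₁ X w∈) (cong (true ∷_) v≡w))
  ∷ splitHead-unique₁ X X!
splitHead-unique₁ ((false ∷ v) ∷ X) (_   ∷ X!) = splitHead-unique₁ X X!

unique-vertices-bound : ∀ {n} (X : List (Vertex n)) → Unique X → length X ≤ 2 ^ n
unique-vertices-bound {zero}  []                          _ = z≤n
unique-vertices-bound {zero}  ([] ∷ [])                   _ = ℕ.s≤s z≤n
unique-vertices-bound {zero}  ([] ∷ [] ∷ X) ((≢[] ∷ _) ∷ _) = ⊥-elim (≢[] refl)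
unique-vertices-bound {suc n} X X! = begin
  length X                                                   ≡⟨ length-splitHead X ⟩
  length (proj₁ (splitHead X)) ℕ.+ length (proj₂ (splitHead X))
    ≤⟨ NP.+-mono-≤ (unique-vertices-bound _ (splitHead-unique₀ X X!))
                   (unique-vertices-bound _ (splitHead-unique₁ X X!)) ⟩
  2 ^ n ℕ.+ 2 ^ n                                            ≡⟨ cong (2 ^ n ℕ.+_) (sym (NP.+-identityʳ (2 ^ n))) ⟩
  2 ^ suc n                                                  ∎
  where open NP.≤-Reasoning

m*2^d≤2^n⇒m*2^[1+d]≤2^[1+n] : ∀ m d n → m ℕ.* 2 ^ d ≤ 2 ^ n → m ℕ.* 2 ^ suc d ≤ 2 ^ suc n
m*2^d≤2^n⇒m*2^[1+d]≤2^[1+n] m d n m*2^d≤2^n = begin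
  m ℕ.* (2 ℕ.* 2 ^ d)   ≡⟨ NP.*-comm m (2 ℕ.* 2 ^ d) ⟩
  2 ℕ.* 2 ^ d ℕ.* m     ≡⟨ NP.*-assoc 2 (2 ^ d) m ⟩
  2 ℕ.* (2 ^ d ℕ.* m)   ≡⟨ cong (2 ℕ.*_) (NP.*-comm (2 ^ d) m) ⟩
  2 ℕ.* (m ℕ.* 2 ^ d)   ≤⟨ NP.*-monoʳ-≤ 2 m*2^d≤2^n ⟩
  2 ℕ.* 2 ^ n           ∎
  where open NP.≤-Reasoning

module Pivot {n} (f : Affine (suc n)) (p : Fin (suc n)) (fp≢0 : coeff f p ≢ 0ℚ) where

  private instance
    fp-nonZero : ℚ.NonZero (coeff f p)
    fp-nonZero = ℚ.≢-nonZero fp≢0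

  ratio : Affine (suc n) → ℚ
  ratio g = coeff g p * 1/ coeff f p

  coeff≡ratio*pivot : ∀ g → coeff g p ≡ ratio g * coeff f p
  coeff≡ratio*pivot g = sym (begin
    coeff g p * 1/ coeff f p * coeff f p      ≡⟨ QP.*-assoc (coeff g p) (1/ coeff f p) (coeff f p) ⟩
    coeff g p * (1/ coeff f p * coeff f p)    ≡⟨ cong (coeff g p *_) (QP.*-inverseˡ (coeff f p)) ⟩
    coeff g p * 1ℚ                            ≡⟨ QP.*-identityʳ (coeff g p) ⟩
    coeff g p                                 ∎)
    where open ≡-Reasoning

  -- g - ratio g · f has p-th coefficient 0, which is dropped.
  eliminate : Affine (suc n) → Affine n
  eliminate g = affine (λ j → coeff g (punchIn p j) - ratio g * coeff f (punchIn p j))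
                       (offset g - ratio g * offset f)

  rest : Affine (suc n) → Point (suc n) → ℚ
  rest g x = ∑ (λ j → coeff g (punchIn p j) * x (punchIn p j))

  eval-remove : ∀ g x → eval g x ≡ (coeff g p * x p + rest g x) - offset g
  eval-remove g x = cong (_- offset g) (∑-remove p (λ i → coeff g i * x i))

  eval-eliminate : ∀ g (x : Point (suc n)) → eval (eliminate g) (x ∘ punchIn p) ≡ eval g x - ratio g * eval f x
  eval-eliminate g x = begin
    eval (eliminate g) (x ∘ punchIn p)
      ≡⟨ cong (_- offset (eliminate g))
              (trans (∑-cong expand) (∑-distrib-+ (λ j → coeff g (punchIn p j) * x (punchIn p j)) _)) ⟩
    (rest g x + ∑ (λ j → - ratio g * (coeff f (punchIn p j) * x (punchIn p j)))) - offset (eliminate g)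
      ≡⟨ cong (λ t → (rest g x + t) - offset (eliminate g))
              (sym (*-distribˡ-∑ (- ratio g) (λ j → coeff f (punchIn p j) * x (punchIn p j)))) ⟩
    (rest g x + (- ratio g) * rest f x) - (offset g - ratio g * offset f)
      ≡⟨ solve 7 (λ r a xp sg sf cg cf →
            (sg :+ (:- r) :* sf) :- (cg :- r :* cf) :=
            ((r :* a) :* xp :+ sg) :- cg :- r :* ((a :* xp :+ sf) :- cf)) refl
           (ratio g) (coeff f p) (x p) (rest g x) (rest f x) (offset g) (offset f) ⟩
    ((ratio g * coeff f p) * x p + rest g x) - offset g - ratio g * ((coeff f p * x p + rest f x) - offset f)
      ≡⟨ cong₂ (λ u w → u - ratio g * w)
           (trans (cong (λ c → (c * x p + rest g x) - offset g) (sym (coeff≡ratio*pivot g))) (sym (eval-remove g x)))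
           (sym (eval-remove f x)) ⟩
    eval g x - ratio g * eval f x ∎
    where
    open ≡-Reasoning
    expand : ∀ j → (coeff g (punchIn p j) - ratio g * coeff f (punchIn p j)) * x (punchIn p j)
                 ≡ coeff g (punchIn p j) * x (punchIn p j) + - ratio g * (coeff f (punchIn p j) * x (punchIn p j))
    expand j = solve 4 (λ c r d y → (c :- r :* d) :* y := c :* y :+ (:- r) :* (d :* y)) refl
                 (coeff g (punchIn p j)) (ratio g) (coeff f (punchIn p j)) (x (punchIn p j))

  ratioComb : List ℚ → List (Affine (suc n)) → ℚ
  ratioComb (c ∷ cs) (g ∷ G) = c * ratio g + ratioComb cs G
  ratioComb _        _       = 0ℚ

  linComb-eliminate : ∀ cs G x →
    linComb cs (L.map eliminate G) (x ∘ punchIn p) ≡ linComb cs G x - ratioComb cs G * eval f x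
  linComb-eliminate (c ∷ cs) (g ∷ G) x =
    trans (cong₂ (λ u w → c * u + w) (eval-eliminate g x) (linComb-eliminate cs G x))
      (solve 6 (λ c eg r ef l m → c :* (eg :- r :* ef) :+ (l :- m :* ef) := (c :* eg :+ l) :- (c :* r :+ m) :* ef)
         refl c (eval g x) (ratio g) (eval f x) (linComb cs G x) (ratioComb cs G))
  linComb-eliminate []       G       x = sym (solve 1 (λ e → con 0ℚ :- con 0ℚ :* e := con 0ℚ) refl (eval f x))
  linComb-eliminate (c ∷ cs) []      x = sym (solve 1 (λ e → con 0ℚ :- con 0ℚ :* e := con 0ℚ) refl (eval f x))

  dependent-lift : ∀ G → Dependent (L.map eliminate G) → Dependent (f ∷ G)
  dependent-lift G (cs , |cs| , cs≢0 , cs-vanish) =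
    - ratioComb cs G ∷ cs , cong suc (trans |cs| (LP.length-map eliminate G)) , there cs≢0 , vanish
    where
    vanish : ∀ x → - ratioComb cs G * eval f x + linComb cs G x ≡ 0ℚ
    vanish x = begin
      - ratioComb cs G * eval f x + linComb cs G x
        ≡⟨ solve 3 (λ m e l → (:- m) :* e :+ l := l :- m :* e) refl (ratioComb cs G) (eval f x) (linComb cs G x) ⟩
      linComb cs G x - ratioComb cs G * eval f x   ≡⟨ sym (linComb-eliminate cs G x) ⟩
      linComb cs (L.map eliminate G) (x ∘ punchIn p) ≡⟨ cs-vanish (x ∘ punchIn p) ⟩
      0ℚ                                            ∎
      where open ≡-Reasoning

  pivot-determined : ∀ {x y : Point (suc n)} → Zeros f x → Zeros f y →
    (∀ j → x (punchIn p j) ≡ y (punchIn p j)) → x p ≡ y p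
  pivot-determined {x} {y} fx fy x≡y-off-p = *-cancelˡ-≡ fp≢0 (ℚ-Group.∙-cancelʳ (rest f x) _ _ (begin
    coeff f p * x p + rest f x   ≡⟨ p-q≡0⇒p≡q _ _ (trans (sym (eval-remove f x)) fx) ⟩
    offset f                     ≡⟨ sym (p-q≡0⇒p≡q _ _ (trans (sym (eval-remove f y)) fy)) ⟩
    coeff f p * y p + rest f y   ≡⟨ cong (coeff f p * y p +_) (sym rest≡) ⟩
    coeff f p * y p + rest f x   ∎))
    where
    open ≡-Reasoning
    rest≡ : rest f x ≡ rest f y
    rest≡ = ∑-cong (λ j → cong (coeff f (punchIn p j) *_) (x≡y-off-p j))

  restrict : Vertex (suc n) → Vertex n
  restrict v = tabulate (λ j → lookup v (punchIn p j))

  embed-restrict : ∀ v j → embed (restrict v) j ≡ embed v (punchIn p j)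
  embed-restrict v j = cong bit (VP.lookup∘tabulate _ j)

  restrict-commonZero : ∀ G {v} → CommonZero (f ∷ G) v → CommonZero (L.map eliminate G) (restrict v)
  restrict-commonZero G {v} (fv ∷ Gv) = AllP.map⁺ (All.map (λ {g} gv → begin
    eval (eliminate g) (embed (restrict v))           ≡⟨ eval-cong (eliminate g) (embed-restrict v) ⟩
    eval (eliminate g) (embed v ∘ punchIn p)          ≡⟨ eval-eliminate g (embed v) ⟩
    eval g (embed v) - ratio g * eval f (embed v)     ≡⟨ cong₂ (λ u w → u - ratio g * w) gv fv ⟩
    0ℚ - ratio g * 0ℚ                                 ≡⟨ solve 1 (λ r → con 0ℚ :- r :* con 0ℚ := con 0ℚ) refl (ratio g) ⟩
    0ℚ                                                ∎) Gv)
    where open ≡-Reasoning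

  restrict-injective : ∀ {u v} → Zeros f (embed u) → Zeros f (embed v) → restrict u ≡ restrict v → u ≡ v
  restrict-injective {u} {v} fu fv ru≡rv = embed-injective u≈v
    where
    off-p : ∀ j → embed u (punchIn p j) ≡ embed v (punchIn p j)
    off-p j = trans (sym (embed-restrict u j)) (trans (cong (λ w → embed w j) ru≡rv) (embed-restrict v j))
    u≈v : embed u ≈ₚ embed v
    u≈v i with p FP.≟ i
    ... | yes refl = pivot-determined {embed u} {embed v} fu fv off-p
    ... | no p≢i   = subst (λ k → embed u k ≡ embed v k) (FP.punchIn-punchOut p≢i) (off-p (punchOut p≢i))

  restrict-unique : ∀ {G X} → Unique X → All (CommonZero (f ∷ G)) X → Unique (L.map restrict X)
  restrict-unique X! zs = unique-map⁺ restrict (λ {u} {v} → restrict-injective {u} {v}) (All.map All.head zs) X!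

  restrict-commonZeros : ∀ G {X} → All (CommonZero (f ∷ G)) X → All (CommonZero (L.map eliminate G)) (L.map restrict X)
  restrict-commonZeros G zs = AllP.map⁺ (All.map (λ {v} → restrict-commonZero G {v}) zs)

  lift-bound : ∀ G (X : List (Vertex (suc n))) →
    Dependent (L.map eliminate G) ⊎ length (L.map restrict X) ℕ.* 2 ^ length (L.map eliminate G) ≤ 2 ^ n →
    Dependent (f ∷ G) ⊎ length X ℕ.* 2 ^ length (f ∷ G) ≤ 2 ^ suc n
  lift-bound G X (inj₁ dep)   = inj₁ (dependent-lift G dep)
  lift-bound G X (inj₂ bound) = inj₂ (m*2^d≤2^n⇒m*2^[1+d]≤2^[1+n] (length X) (length G) n
    (subst₂ (λ l d → l ℕ.* 2 ^ d ≤ 2 ^ n) (LP.length-map restrict X) (LP.length-map eliminate G) bound))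

-- A nonconstant equation determines its pivot coordinate from the others, so dropping that
-- coordinate is injective on its zeros; each independent equation thus halves the vertex count.
mutual
  common-zeros-bound : ∀ {n} (F : List (Affine n)) (X : List (Vertex n)) → Unique X → All (CommonZero F) X →
    Dependent F ⊎ length X ℕ.* 2 ^ length F ≤ 2 ^ n
  common-zeros-bound []      X  X! _ = inj₂ (subst (_≤ _) (sym (NP.*-identityʳ _)) (unique-vertices-bound X X!))
  common-zeros-bound (f ∷ F) [] _  _ = inj₂ z≤n
  common-zeros-bound (f ∷ F) X@(_ ∷ _) X! zs@((fv ∷ _) ∷ _) with FP.all? (λ i → coeff f i QP.≟ 0ℚ)
  ... | yes f-const    = inj₁ (vanishing-constant⇒dependent f F f-const fv)
  ... | no  f-nonconst = pivot-step f F X X! zs (FP.¬∀⟶∃¬ _ _ (λ i → coeff f i QP.≟ 0ℚ) f-nonconst)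

  pivot-step : ∀ {n} (f : Affine n) (F : List (Affine n)) (X : List (Vertex n)) → Unique X →
    All (CommonZero (f ∷ F)) X → Σ (Fin n) (λ p → coeff f p ≢ 0ℚ) →
    Dependent (f ∷ F) ⊎ length X ℕ.* 2 ^ length (f ∷ F) ≤ 2 ^ n
  pivot-step {zero}  f F X X! zs (() , _)
  pivot-step {suc n} f F X X! zs (p , fp≢0) =
    lift-bound F X (common-zeros-bound (L.map eliminate F) (L.map restrict X)
                                       (restrict-unique X! zs) (restrict-commonZeros F zs))
    where open Pivot f p fp≢0

-- The hyperoctahedral group B_n

idₛ : ∀ {n} → SignedPerm n
idₛ = record { perm = Perm.id ; sign = λ _ → false }

_⁻¹ₛ : ∀ {n} → SignedPerm n → SignedPerm n
w ⁻¹ₛ = record { perm = Perm.flip (perm w) ; sign = λ j → sign w (perm w ⟨$⟩ˡ j) }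

_∘ₛ_ : ∀ {n} → SignedPerm n → SignedPerm n → SignedPerm n
w ∘ₛ v = record { perm = perm w Perm.∘ₚ perm v ; sign = λ i → sign w i xor sign v (perm w ⟨$⟩ʳ i) }

reflectIf : Bool → ℚ → ℚ
reflectIf s t = if s then 1ℚ - t else t

reflectIf-involutive : ∀ s t → reflectIf s (reflectIf s t) ≡ t
reflectIf-involutive false t = refl
reflectIf-involutive true  t = solve 1 (λ t → con 1ℚ :- (con 1ℚ :- t) := t) refl t

reflectIf-xor : ∀ a b t → reflectIf (a xor b) t ≡ reflectIf a (reflectIf b t)
reflectIf-xor false b     t = refl
reflectIf-xor true  false t = refl
reflectIf-xor true  true  t = sym (reflectIf-involutive true t)

≈ₚ-sym : ∀ {n} {x y : Point n} → x ≈ₚ y → y ≈ₚ x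
≈ₚ-sym x≈y i = sym (x≈y i)

≈ₚ-trans : ∀ {n} {x y z : Point n} → x ≈ₚ y → y ≈ₚ z → x ≈ₚ z
≈ₚ-trans x≈y y≈z i = trans (x≈y i) (y≈z i)

act-cong : ∀ {n} (w : SignedPerm n) {x y : Point n} → x ≈ₚ y → act w x ≈ₚ act w y
act-cong w x≈y i = cong (reflectIf (sign w i)) (x≈y _)

act-inverseʳ : ∀ {n} (w : SignedPerm n) (y : Point n) → act w (act (w ⁻¹ₛ) y) ≈ₚ y
act-inverseʳ w y i rewrite Perm.inverseˡ (perm w) {i} = reflectIf-involutive (sign w i) (y i)

act-inverseˡ : ∀ {n} (w : SignedPerm n) (x : Point n) → act (w ⁻¹ₛ) (act w x) ≈ₚ x
act-inverseˡ w x j rewrite Perm.inverseʳ (perm w) {j} = reflectIf-involutive (sign w (perm w ⟨$⟩ˡ j)) (x j)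

act-∘ : ∀ {n} (w v : SignedPerm n) (x : Point n) → act (w ∘ₛ v) x ≈ₚ act w (act v x)
act-∘ w v x i = reflectIf-xor (sign w i) (sign v (perm w ⟨$⟩ʳ i)) _

actᵥ : ∀ {n} → SignedPerm n → Vertex n → Vertex n
actᵥ w v = tabulate (λ i → sign w i xor lookup v (perm w ⟨$⟩ʳ i))

embed-actᵥ : ∀ {n} (w : SignedPerm n) (v : Vertex n) → embed (actᵥ w v) ≈ₚ act w (embed v)
embed-actᵥ w v i = trans (cong bit (VP.lookup∘tabulate _ i)) (bit-xor (sign w i) (lookup v (perm w ⟨$⟩ʳ i)))
  where
  bit-xor : ∀ s b → bit (s xor b) ≡ reflectIf s (bit b)
  bit-xor false b     = refl
  bit-xor true  false = refl
  bit-xor true  true  = refl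

actᵥ-inverseˡ : ∀ {n} (w : SignedPerm n) (v : Vertex n) → actᵥ (w ⁻¹ₛ) (actᵥ w v) ≡ v
actᵥ-inverseˡ w v = embed-injective (≈ₚ-trans (embed-actᵥ (w ⁻¹ₛ) (actᵥ w v))
  (≈ₚ-trans (act-cong (w ⁻¹ₛ) (embed-actᵥ w v)) (act-inverseˡ w (embed v))))

actᵥ-injective : ∀ {n} (w : SignedPerm n) {u v : Vertex n} → actᵥ w u ≡ actᵥ w v → u ≡ v
actᵥ-injective w {u} {v} eq = trans (sym (actᵥ-inverseˡ w u)) (trans (cong (actᵥ (w ⁻¹ₛ)) eq) (actᵥ-inverseˡ w v))

actCombo : ∀ {n} → SignedPerm n → List (ℚ × Vertex n) → List (ℚ × Vertex n)
actCombo w = L.map (λ (c , v) → c , actᵥ w v)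

weightSum-actCombo : ∀ {n} (w : SignedPerm n) cs → weightSum (actCombo w cs) ≡ weightSum cs
weightSum-actCombo w []             = refl
weightSum-actCombo w ((c , v) ∷ cs) = cong (c +_) (weightSum-actCombo w cs)

combo-actCombo : ∀ {n} (w : SignedPerm n) cs (i : Fin n) →
  combo (actCombo w cs) i ≡
  (if sign w i then weightSum cs - combo cs (perm w ⟨$⟩ʳ i) else combo cs (perm w ⟨$⟩ʳ i))
combo-actCombo w [] i with sign w i
... | false = refl
... | true  = refl
combo-actCombo w ((c , v) ∷ cs) i =
  trans (cong₂ _+_ (cong (c *_) (embed-actᵥ w v i)) (combo-actCombo w cs i))
        (step (sign w i) c (embed v (perm w ⟨$⟩ʳ i)) (weightSum cs) (combo cs (perm w ⟨$⟩ʳ i)))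
  where
  step : ∀ s c e W C → c * reflectIf s e + (if s then W - C else C) ≡ (if s then (c + W) - (c * e + C) else c * e + C)
  step false c e W C = refl
  step true  c e W C = solve 4 (λ c e W C → c :* (con 1ℚ :- e) :+ (W :- C) := (c :+ W) :- (c :* e :+ C)) refl c e W C

convV-resp : ∀ {n} (U : List (Vertex n)) {x y : Point n} → x ≈ₚ y → convV U x → convV U y
convV-resp U x≈y (cs , cs∈U , Σcs≡1 , cs≈x) = cs , cs∈U , Σcs≡1 , ≈ₚ-trans cs≈x x≈y

convV-mono : ∀ {n} {U U′ : List (Vertex n)} → (∀ {v} → v ∈ U → v ∈ U′) → ∀ x → convV U x → convV U′ x
convV-mono U⊆U′ x (cs , cs∈U , Σcs≡1 , cs≈x) =
  cs , All.map (λ (c≥0 , v∈U) → c≥0 , U⊆U′ v∈U) cs∈U , Σcs≡1 , cs≈x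

act-convV : ∀ {n} (w : SignedPerm n) (U : List (Vertex n)) x → convV U x → convV (L.map (actᵥ w) U) (act w x)
act-convV w U x (cs , cs∈U , Σcs≡1 , cs≈x) =
  actCombo w cs ,
  AllP.map⁺ (All.map (λ (c≥0 , v∈U) → c≥0 , MP.∈-map⁺ (actᵥ w) v∈U) cs∈U) ,
  trans (weightSum-actCombo w cs) Σcs≡1 ,
  λ i → trans (combo-actCombo w cs i) (cong₂ (λ W C → if sign w i then W - C else C) Σcs≡1 (cs≈x _))

RespectsEq : ∀ {n} → PSet n → Set
RespectsEq {n} A = ∀ {x y : Point n} → x ≈ₚ y → A x → A y

≐-sym : ∀ {n} {A B : PSet n} → A ≐ B → B ≐ A
≐-sym A≐B x = proj₂ (A≐B x) , proj₁ (A≐B x)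

≐-trans : ∀ {n} {A B C : PSet n} → A ≐ B → B ≐ C → A ≐ C
≐-trans A≐B B≐C x = proj₁ (B≐C x) ∘ proj₁ (A≐B x) , proj₂ (A≐B x) ∘ proj₂ (B≐C x)

image-resp : ∀ {n} w (A : PSet n) → RespectsEq (image w A)
image-resp w A y≈z (x , ax , wx≈y) = x , ax , ≈ₚ-trans wx≈y y≈z

image-cong : ∀ {n} w {A B : PSet n} → A ≐ B → image w A ≐ image w B
image-cong w A≐B y = (λ (x , ax , q) → x , proj₁ (A≐B x) ax , q) , (λ (x , bx , q) → x , proj₂ (A≐B x) bx , q)

image-∘ : ∀ {n} w v (A : PSet n) → image (w ∘ₛ v) A ≐ image w (image v A)
image-∘ w v A y =
  (λ (x , ax , q) → act v x , (x , ax , λ _ → refl) , ≈ₚ-trans (≈ₚ-sym (act-∘ w v x)) q) ,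
  (λ (z , (x , ax , q) , q′) → x , ax , ≈ₚ-trans (act-∘ w v x) (≈ₚ-trans (act-cong w q) q′))

act⁻¹-image : ∀ {n} w {A : PSet n} → RespectsEq A → ∀ {y} → image w A y → A (act (w ⁻¹ₛ) y)
act⁻¹-image w A-resp (x , Ax , wx≈y) = A-resp (≈ₚ-trans (≈ₚ-sym (act-inverseˡ w x)) (act-cong (w ⁻¹ₛ) wx≈y)) Ax

image-inverseˡ : ∀ {n} w (A : PSet n) → RespectsEq A → image (w ⁻¹ₛ) (image w A) ≐ A
image-inverseˡ w A A-resp y =
  (λ (z , z∈wA , w⁻¹z≈y) → A-resp w⁻¹z≈y (act⁻¹-image w A-resp z∈wA)) ,
  (λ ay → act w y , (y , ay , λ _ → refl) , act-inverseˡ w y)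

image-id : ∀ {n} (A : PSet n) → RespectsEq A → image idₛ A ≐ A
image-id A A-resp y = (λ (x , ax , q) → A-resp q ax) , (λ ay → y , ay , λ _ → refl)

image-convV : ∀ {n} (w : SignedPerm n) (U : List (Vertex n)) → image w (convV U) ≐ convV (L.map (actᵥ w) U)
image-convV w U y =
  (λ (x , x∈ , wx≈y) → convV-resp _ wx≈y (act-convV w U x x∈)) ,
  (λ y∈ → act (w ⁻¹ₛ) y , convV-mono back _ (act-convV (w ⁻¹ₛ) _ y y∈) , act-inverseʳ w y)
  where
  back : ∀ {v} → v ∈ L.map (actᵥ (w ⁻¹ₛ)) (L.map (actᵥ w) U) → v ∈ U
  back v∈ with MP.∈-map⁻ (actᵥ (w ⁻¹ₛ)) v∈
  ... | u , u∈ , refl with MP.∈-map⁻ (actᵥ w) u∈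
  ... | u′ , u′∈U , refl = subst (_∈ U) (sym (actᵥ-inverseˡ w u′)) u′∈U

≅B-refl : ∀ {n} {A : PSet n} → RespectsEq A → A ≅B A
≅B-refl {A = A} A-resp = idₛ , image-id A A-resp

≅B-sym : ∀ {n} {A B : PSet n} → RespectsEq A → A ≅B B → B ≅B A
≅B-sym {A = A} A-resp (w , wA≐B) = w ⁻¹ₛ , ≐-trans (image-cong (w ⁻¹ₛ) (≐-sym wA≐B)) (image-inverseˡ w A A-resp)

≅B-trans : ∀ {n} {A B C : PSet n} → A ≅B B → B ≅B C → A ≅B C
≅B-trans {A = A} (w , wA≐B) (v , vB≐C) = v ∘ₛ w , ≐-trans (image-∘ v w A) (≐-trans (image-cong v wA≐B) vB≐C)

polySet-resp : ∀ {n} (P : Polytope01 n) → RespectsEq (polySet P)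
polySet-resp P = convV-resp (verts P)

vertex∈polySet : ∀ {n} (P : Polytope01 n) {v} → v ∈ verts P → polySet P (embed v)
vertex∈polySet P {v} v∈P = (1ℚ , v) ∷ [] , (QP.nonNegative⁻¹ 1ℚ , v∈P) ∷ [] , QP.+-identityʳ 1ℚ ,
  λ i → trans (QP.+-identityʳ _) (QP.*-identityˡ _)

∼-refl : ∀ {n} (P : Polytope01 n) → P ∼ P
∼-refl P = ≅B-refl (polySet-resp P)

∼-sym : ∀ {n} {P Q : Polytope01 n} → P ∼ Q → Q ∼ P
∼-sym {P = P} = ≅B-sym (polySet-resp P)

∼-trans : ∀ {n} {P Q R : Polytope01 n} → P ∼ Q → Q ∼ R → P ∼ R
∼-trans = ≅B-trans

actₚ : ∀ {n} → SignedPerm n → Polytope01 n → Polytope01 n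
actₚ w P = record
  { verts    = L.map (actᵥ w) (verts P)
  ; distinct = UniqueP.map⁺ (actᵥ-injective w) (distinct P)
  ; nonempty = map≢[] (verts P) (nonempty P)
  }
  where
  map≢[] : ∀ U → U ≢ [] → L.map (actᵥ w) U ≢ []
  map≢[] []      U≢[] = ⊥-elim (U≢[] refl)
  map≢[] (_ ∷ _) _    = λ ()

polySet-actₚ : ∀ {n} w (P : Polytope01 n) → polySet (actₚ w P) ≐ image w (polySet P)
polySet-actₚ w P = ≐-sym (image-convV w (verts P))

numVerts-actₚ : ∀ {n} w (P : Polytope01 n) → numVerts (actₚ w P) ≡ numVerts P
numVerts-actₚ w P = LP.length-map (actᵥ w) (verts P)

∼-actₚ : ∀ {n} w (P : Polytope01 n) → P ∼ actₚ w P
∼-actₚ w P = w , ≐-sym (polySet-actₚ w P)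

signedCoeff : ∀ {n} → SignedPerm n → Affine n → Fin n → ℚ
signedCoeff w f i = if sign w i then - coeff f i else coeff f i

reflectShift : ∀ {n} → SignedPerm n → Affine n → Fin n → ℚ
reflectShift w f i = if sign w i then coeff f i else 0ℚ

pullback : ∀ {n} → SignedPerm n → Affine n → Affine n
pullback w f = affine (λ j → signedCoeff w f (perm w ⟨$⟩ˡ j)) (offset f - ∑ (reflectShift w f))

eval-pullback : ∀ {n} (w : SignedPerm n) (f : Affine n) (x : Point n) → eval (pullback w f) x ≡ eval f (act w x)
eval-pullback {n} w f x = begin
  ∑ (λ j → signedCoeff w f (perm w ⟨$⟩ˡ j) * x j) - (offset f - D)
    ≡⟨ cong (_- (offset f - D)) reindex ⟩
  T - (offset f - D)
    ≡⟨ solve 3 (λ t c d → t :- (c :- d) := (t :+ d) :- c) refl T (offset f) D ⟩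
  (T + D) - offset f
    ≡⟨ cong (_- offset f) (sym (trans (∑-cong (λ i → *-reflectIf (sign w i) (coeff f i) _))
                                      (∑-distrib-+ (λ i → signedCoeff w f i * x (perm w ⟨$⟩ʳ i)) (reflectShift w f)))) ⟩
  eval f (act w x) ∎
  where
  open ≡-Reasoning
  D = ∑ (reflectShift w f)
  T = ∑ (λ i → signedCoeff w f i * x (perm w ⟨$⟩ʳ i))
  reindex : ∑ (λ j → signedCoeff w f (perm w ⟨$⟩ˡ j) * x j) ≡ T
  reindex = trans (∑-permute (perm w) (λ j → signedCoeff w f (perm w ⟨$⟩ˡ j) * x j))
                  (∑-cong (λ i → cong (λ k → signedCoeff w f k * x (perm w ⟨$⟩ʳ i)) (Perm.inverseˡ (perm w))))
  *-reflectIf : ∀ s c t → c * reflectIf s t ≡ (if s then - c else c) * t + (if s then c else 0ℚ)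
  *-reflectIf false c t = sym (QP.+-identityʳ _)
  *-reflectIf true  c t = solve 2 (λ c t → c :* (con 1ℚ :- t) := (:- c) :* t :+ c) refl c t

IdenticallyZero : ∀ {n} → Affine n → Set
IdenticallyZero f = ∀ x → Zeros f x

pullback-identicallyZero : ∀ {n} w (f : Affine n) → IdenticallyZero (pullback w f) → IdenticallyZero f
pullback-identicallyZero w f f∘w≡0 z = begin
  eval f z                          ≡⟨ eval-cong f (≈ₚ-sym (act-inverseʳ w z)) ⟩
  eval f (act w (act (w ⁻¹ₛ) z))    ≡⟨ sym (eval-pullback w f (act (w ⁻¹ₛ) z)) ⟩
  eval (pullback w f) (act (w ⁻¹ₛ) z) ≡⟨ f∘w≡0 (act (w ⁻¹ₛ) z) ⟩
  0ℚ                                ∎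
  where open ≡-Reasoning

unit : ∀ {n} → Fin n → Point n
unit p i = bit (does (i FP.≟ p))

coeff≢0⇒¬identicallyZero : ∀ {n} (f : Affine n) (p : Fin n) → coeff f p ≢ 0ℚ → ¬ IdenticallyZero f
coeff≢0⇒¬identicallyZero {suc n} f p fp≢0 f≡0 = fp≢0 (begin
  coeff f p                          ≡⟨ sym ∑-unit ⟩
  ∑ (λ i → coeff f i * unit p i)     ≡⟨ p-q≡0⇒p≡q _ _ (f≡0 (unit p)) ⟩
  offset f                           ≡⟨ sym (p-q≡0⇒p≡q _ _ (f≡0 (λ _ → 0ℚ))) ⟩
  ∑ (λ i → coeff f i * 0ℚ)           ≡⟨ ∑-zero (λ i → QP.*-zeroʳ (coeff f i)) ⟩
  0ℚ                                 ∎)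
  where
  open ≡-Reasoning
  unit-off-p : ∀ j → coeff f (punchIn p j) * unit p (punchIn p j) ≡ 0ℚ
  unit-off-p j = trans (cong (λ b → coeff f (punchIn p j) * bit b) (dec-false (punchIn p j FP.≟ p) (FP.punchInᵢ≢i p j)))
                       (QP.*-zeroʳ (coeff f (punchIn p j)))
  ∑-unit : ∑ (λ i → coeff f i * unit p i) ≡ coeff f p
  ∑-unit = begin
    ∑ (λ i → coeff f i * unit p i)                         ≡⟨ ∑-remove p (λ i → coeff f i * unit p i) ⟩
    coeff f p * unit p p + ∑ (λ j → coeff f (punchIn p j) * unit p (punchIn p j))
      ≡⟨ cong₂ _+_ (cong (λ b → coeff f p * bit b) (dec-true (p FP.≟ p) refl)) (∑-zero unit-off-p) ⟩
    coeff f p * 1ℚ + 0ℚ                                    ≡⟨ solve 1 (λ c → c :* con 1ℚ :+ con 0ℚ := c) refl (coeff f p) ⟩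
    coeff f p                                              ∎

-- Intersections of two hyperplanes

proportional⇒zeros-≐ : ∀ {n} {f g : Affine n} {c d} → c ≢ 0ℚ → d ≢ 0ℚ →
  (∀ x → c * eval f x + d * eval g x ≡ 0ℚ) → Zeros f ≐ Zeros g
proportional⇒zeros-≐ {f = f} {g} {c} {d} c≢0 d≢0 rel x =
  (λ fx → p≢0∧p*q≡0⇒q≡0 d≢0
     (trans (sym (QP.+-identityˡ _)) (trans (cong (_+ d * eval g x) (sym (*-zeroed {c} fx))) (rel x)))) ,
  (λ gx → p≢0∧p*q≡0⇒q≡0 c≢0
     (trans (sym (QP.+-identityʳ _)) (trans (cong (c * eval f x +_) (sym (*-zeroed {d} gx))) (rel x))))
  where
  *-zeroed : ∀ {e t} → t ≡ 0ℚ → e * t ≡ 0ℚ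
  *-zeroed {e} refl = QP.*-zeroʳ e

module Codimension2 {n} {f g : Affine n}
  (f≢0 : ¬ IdenticallyZero f) (g≢0 : ¬ IdenticallyZero g) (f≉g : ¬ (Zeros f ≐ Zeros g)) where

  no-pair-relation : ∀ c d → Any (_≢ 0ℚ) (c ∷ d ∷ []) → ¬ (∀ x → c * eval f x + d * eval g x ≡ 0ℚ)
  no-pair-relation c d c∨d≢0 rel with c QP.≟ 0ℚ | d QP.≟ 0ℚ
  ... | yes refl | yes refl = none c∨d≢0
    where
    none : ¬ Any (_≢ 0ℚ) (0ℚ ∷ 0ℚ ∷ [])
    none (here 0≢0)         = 0≢0 refl
    none (there (here 0≢0)) = 0≢0 refl
  ... | yes refl | no d≢0 = g≢0 (λ x → p≢0∧p*q≡0⇒q≡0 d≢0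
          (trans (solve 2 (λ e t → t := con 0ℚ :* e :+ t) refl (eval f x) (d * eval g x)) (rel x)))
  ... | no c≢0 | yes refl = f≢0 (λ x → p≢0∧p*q≡0⇒q≡0 c≢0
          (trans (solve 2 (λ t e → t := t :+ con 0ℚ :* e) refl (c * eval f x) (eval g x)) (rel x)))
  ... | no c≢0 | no d≢0 = f≉g (proportional⇒zeros-≐ {f = f} {g} c≢0 d≢0 rel)

  dependent⇒vanishes-on-flat : ∀ φ → Dependent (f ∷ g ∷ φ ∷ []) → ∀ x → Zeros f x → Zeros g x → Zeros φ x
  dependent⇒vanishes-on-flat φ (c ∷ d ∷ e ∷ [] , _ , c∨d∨e≢0 , rel) x fx gx with e QP.≟ 0ℚ
  ... | no e≢0 = p≢0∧p*q≡0⇒q≡0 e≢0 (begin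
    e * eval φ x
      ≡⟨ solve 3 (λ c d t → t := c :* con 0ℚ :+ (d :* con 0ℚ :+ (t :+ con 0ℚ))) refl c d (e * eval φ x) ⟩
    c * 0ℚ + (d * 0ℚ + (e * eval φ x + 0ℚ))
      ≡⟨ cong₂ (λ u v → c * u + (d * v + (e * eval φ x + 0ℚ))) (sym fx) (sym gx) ⟩
    c * eval f x + (d * eval g x + (e * eval φ x + 0ℚ))        ≡⟨ rel x ⟩
    0ℚ                                                         ∎)
    where open ≡-Reasoning
  ... | yes refl = ⊥-elim (no-pair-relation c d (drop-zero c∨d∨e≢0)
         (λ y → trans (solve 3 (λ a b t → a :+ b := a :+ (b :+ (con 0ℚ :* t :+ con 0ℚ))) refl
                              (c * eval f y) (d * eval g y) (eval φ y))
                      (rel y)))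
    where
    drop-zero : Any (_≢ 0ℚ) (c ∷ d ∷ 0ℚ ∷ []) → Any (_≢ 0ℚ) (c ∷ d ∷ [])
    drop-zero (here c≢0)                 = here c≢0
    drop-zero (there (here d≢0))         = there (here d≢0)
    drop-zero (there (there (here 0≢0))) = ⊥-elim (0≢0 refl)

  -- Were f, g, φ independent, they would have at most 2^(n-3) common zeros among the vertices.
  large-vertex-set-spans : (X : List (Vertex n)) → Unique X → 2 ^ n < length X ℕ.* 2 ^ 3 →
    ∀ φ → All (CommonZero (f ∷ g ∷ φ ∷ [])) X → ∀ x → Zeros f x → Zeros g x → Zeros φ x
  large-vertex-set-spans X X! large φ zs with common-zeros-bound (f ∷ g ∷ φ ∷ []) X X! zs
  ... | inj₁ dep   = dependent⇒vanishes-on-flat φ dep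
  ... | inj₂ bound = ⊥-elim (NP.<⇒≱ large bound)

equation : ∀ {n} → Hyperplane n → Affine n
equation H = affine (Hyperplane.a H) (Hyperplane.b H)

⟦⟧⇒zero : ∀ {n} (H : Hyperplane n) {x} → ⟦ H ⟧ x → Zeros (equation H) x
⟦⟧⇒zero H = p≡q⇒p-q≡0

zero⇒⟦⟧ : ∀ {n} (H : Hyperplane n) {x} → Zeros (equation H) x → ⟦ H ⟧ x
zero⇒⟦⟧ H = p-q≡0⇒p≡q _ _

⟦⟧-resp : ∀ {n} (H : Hyperplane n) → RespectsEq ⟦ H ⟧
⟦⟧-resp H x≈y Hx = zero⇒⟦⟧ H (trans (sym (eval-cong (equation H) x≈y)) (⟦⟧⇒zero H Hx))

equation-¬identicallyZero : ∀ {n} (H : Hyperplane n) → ¬ IdenticallyZero (equation H)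
equation-¬identicallyZero H = coeff≢0⇒¬identicallyZero (equation H) _ (proj₂ (Hyperplane.a≢0 H))

imageEquation : ∀ {n} → SignedPerm n → Hyperplane n → Affine n
imageEquation w H = pullback (w ⁻¹ₛ) (equation H)

image⇒zero : ∀ {n} w (H : Hyperplane n) {y} → image w ⟦ H ⟧ y → Zeros (imageEquation w H) y
image⇒zero w H {y} (x , Hx , wx≈y) = begin
  eval (imageEquation w H) y        ≡⟨ eval-pullback (w ⁻¹ₛ) (equation H) y ⟩
  eval (equation H) (act (w ⁻¹ₛ) y)
    ≡⟨ eval-cong (equation H) (≈ₚ-trans (act-cong (w ⁻¹ₛ) (≈ₚ-sym wx≈y)) (act-inverseˡ w x)) ⟩
  eval (equation H) x               ≡⟨ ⟦⟧⇒zero H Hx ⟩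
  0ℚ                                ∎
  where open ≡-Reasoning

zero⇒image : ∀ {n} w (H : Hyperplane n) {y} → Zeros (imageEquation w H) y → image w ⟦ H ⟧ y
zero⇒image w H {y} wHy =
  act (w ⁻¹ₛ) y , zero⇒⟦⟧ H (trans (sym (eval-pullback (w ⁻¹ₛ) (equation H) y)) wHy) , act-inverseʳ w y

inter-resp : ∀ {n} (Hi Hj : Hyperplane n) w → RespectsEq (Inter Hi Hj w)
inter-resp Hi Hj w x≈y (Hix , wHjx) = ⟦⟧-resp Hi x≈y Hix , image-resp w ⟦ Hj ⟧ x≈y wHjx

module Rigidity {n} (Hi Hj : Hyperplane n) (Hi≇Hj : ¬ (⟦ Hi ⟧ ≅B ⟦ Hj ⟧)) where

  large-polytope-spans-inter : ∀ w (P : Polytope01 n) → polySet P ⊆ₛ Inter Hi Hj w → 2 ^ n < numVerts P ℕ.* 8 →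
    ∀ φ → All (λ v → Zeros φ (embed v)) (verts P) → ∀ x → Inter Hi Hj w x → Zeros φ x
  large-polytope-spans-inter w P P⊆ large φ φP x (Hix , wHjx) =
    large-vertex-set-spans (verts P) (distinct P) large φ
      (All.tabulate (λ {v} v∈P → let (Hiv , wHjv) = P⊆ _ (vertex∈polySet P v∈P) in
                                 ⟦⟧⇒zero Hi Hiv ∷ image⇒zero w Hj wHjv ∷ All.lookup φP v∈P ∷ []))
      x (⟦⟧⇒zero Hi Hix) (image⇒zero w Hj wHjx)
    where
    Hi≠wHj : ¬ (Zeros (equation Hi) ≐ Zeros (imageEquation w Hj))
    Hi≠wHj eq = Hi≇Hj (≅B-sym (⟦⟧-resp Hj) (w , λ x →
      (λ wHjx → zero⇒⟦⟧ Hi (proj₂ (eq x) (image⇒zero w Hj wHjx))) ,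
      (λ Hix → zero⇒image w Hj (proj₁ (eq x) (⟦⟧⇒zero Hi Hix)))))
    open Codimension2 {f = equation Hi} {imageEquation w Hj} (equation-¬identicallyZero Hi)
                      (λ wHj≡0 → equation-¬identicallyZero Hj (pullback-identicallyZero (w ⁻¹ₛ) (equation Hj) wHj≡0))
                      Hi≠wHj

  ∼-maps-inter : ∀ ws wt g (P Q : Polytope01 n) → polySet P ⊆ₛ Inter Hi Hj ws → polySet Q ⊆ₛ Inter Hi Hj wt →
    2 ^ n < numVerts P ℕ.* 8 → image g (polySet P) ≐ polySet Q → ∀ x → Inter Hi Hj ws x → Inter Hi Hj wt (act g x)
  ∼-maps-inter ws wt g P Q P⊆ Q⊆ large gP≐Q x x∈ =
    zero⇒⟦⟧ Hi (pulled (equation Hi) (λ gv∈ → ⟦⟧⇒zero Hi (proj₁ gv∈))) ,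
    zero⇒image wt Hj (pulled (imageEquation wt Hj) (λ gv∈ → image⇒zero wt Hj (proj₂ gv∈)))
    where
    gP⊆ : ∀ {v} → v ∈ verts P → Inter Hi Hj wt (act g (embed v))
    gP⊆ {v} v∈P = Q⊆ _ (proj₁ (gP≐Q _) (embed v , vertex∈polySet P v∈P , λ _ → refl))
    pulled : ∀ φ → (∀ {y} → Inter Hi Hj wt y → Zeros φ y) → Zeros φ (act g x)
    pulled φ φ⊇ = trans (sym (eval-pullback g φ x))
      (large-polytope-spans-inter ws P P⊆ large (pullback g φ)
        (All.tabulate (λ {v} v∈P → trans (eval-pullback g φ (embed v)) (φ⊇ (gP⊆ v∈P)))) x x∈)

-- The map Φ₃

image-mono : ∀ {n} w {A B : PSet n} → A ⊆ₛ B → image w A ⊆ₛ image w B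
image-mono w A⊆B y (x , Ax , wx≈y) = x , A⊆B x Ax , wx≈y

Φ₃-injective : ∀ {n} (Hi Hj : Hyperplane n) {m} (w : Fin m → SignedPerm n) → ¬ (⟦ Hi ⟧ ≅B ⟦ Hj ⟧) →
  (∀ s t → s ≢ t → ¬ (Inter Hi Hj (w s) ≅B Inter Hi Hj (w t))) →
  ∀ s t (P Q : Polytope01 n) → polySet P ⊆ₛ Inter Hi Hj (w s) → polySet Q ⊆ₛ Inter Hi Hj (w t) →
  2 ^ n < numVerts P ℕ.* 8 → 2 ^ n < numVerts Q ℕ.* 8 → P ∼ Q → s ≡ t
Φ₃-injective Hi Hj w Hi≇Hj reps-distinct s t P Q P⊆ Q⊆ largeP largeQ (g , gP≐Q) with s FP.≟ t
... | yes s≡t = s≡t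
... | no  s≢t = ⊥-elim (reps-distinct s t s≢t (g , gIs≐It))
  where
  open Rigidity Hi Hj Hi≇Hj
  gIs≐It : image g (Inter Hi Hj (w s)) ≐ Inter Hi Hj (w t)
  gIs≐It y =
    (λ (x , x∈ , gx≈y) → inter-resp Hi Hj (w t) gx≈y (∼-maps-inter (w s) (w t) g P Q P⊆ Q⊆ largeP gP≐Q x x∈)) ,
    (λ y∈ → act (g ⁻¹ₛ) y ,
            ∼-maps-inter (w t) (w s) (g ⁻¹ₛ) Q P Q⊆ P⊆ largeQ (proj₂ (∼-sym {P = P} {Q} (g , gP≐Q))) y y∈ ,
            act-inverseʳ g y)

inter-poly∈A : ∀ {n} k (Hi Hj : Hyperplane n) w (P : Polytope01 n) → numVerts P ≡ k →
  polySet P ⊆ₛ Inter Hi Hj w → InA k Hi P × InA k Hj P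
inter-poly∈A k Hi Hj w P |P|≡k P⊆ =
  ((P , |P|≡k , λ x x∈P → proj₁ (P⊆ x x∈P)) , ∼-refl P) ,
  ((actₚ (w ⁻¹ₛ) P , trans (numVerts-actₚ (w ⁻¹ₛ) P) |P|≡k , w⁻¹P⊆Hj) ,
   ∼-sym {P = P} {actₚ (w ⁻¹ₛ) P} (∼-actₚ (w ⁻¹ₛ) P))
  where
  w⁻¹P⊆Hj : polySet (actₚ (w ⁻¹ₛ) P) ⊆ₛ ⟦ Hj ⟧
  w⁻¹P⊆Hj z z∈ with proj₁ (polySet-actₚ (w ⁻¹ₛ) P z) z∈
  ... | y , y∈P , w⁻¹y≈z = ⟦⟧-resp Hj w⁻¹y≈z (act⁻¹-image w (⟦⟧-resp Hj) (proj₂ (P⊆ y y∈P)))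

Φ₃-surjective : ∀ {n} k (Hi Hj : Hyperplane n) m (w : Fin m → SignedPerm n) →
  (∀ u → AtLeastVerts k (Inter Hi Hj u) → Σ (Fin m) λ s → Inter Hi Hj u ≅B Inter Hi Hj (w s)) →
  ∀ P → InA k Hi P → InA k Hj P → Σ (DisjUnion k Hi Hj m w) λ x → Φ₃ {n} {k} {Hi} {Hj} {m} {w} x ∼ P
Φ₃-surjective k Hi Hj m w reps-complete P ((Q , |Q|≡k , Q⊆Hi) , Q∼P) ((R , _ , R⊆Hj) , R∼P) =
  land (reps-complete h (verts Q , distinct Q , NP.≤-reflexive (sym |Q|≡k) ,
                         All.tabulate (λ v∈Q → Q⊆Ih _ (vertex∈polySet Q v∈Q))))
  where
  R∼Q : R ∼ Q
  R∼Q = ∼-trans {P = R} {P} {Q} R∼P (∼-sym {P = Q} {P} Q∼P)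
  h = proj₁ R∼Q
  Q⊆Ih : polySet Q ⊆ₛ Inter Hi Hj h
  Q⊆Ih z z∈Q = Q⊆Hi z z∈Q , image-mono h R⊆Hj z (proj₂ (proj₂ R∼Q z) z∈Q)
  land : Σ (Fin m) (λ s → Inter Hi Hj h ≅B Inter Hi Hj (w s)) →
         Σ (DisjUnion k Hi Hj m w) λ x → Φ₃ {_} {k} {Hi} {Hj} {m} {w} x ∼ P
  land (s , v , vIh≐Is) =
    (s , actₚ v Q , trans (numVerts-actₚ v Q) |Q|≡k ,
     λ z z∈ → proj₁ (vIh≐Is z) (image-mono v Q⊆Ih z (proj₁ (polySet-actₚ v Q z) z∈))) ,
    ∼-trans {P = actₚ v Q} {Q} {P} (∼-sym {P = Q} {actₚ v Q} (∼-actₚ v Q)) Q∼P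

2^[n∸3]<k⇒2^n<k*8 : ∀ n k → 3 ≤ n → 2 ^ (n ∸ 3) < k → 2 ^ n < k ℕ.* 8
2^[n∸3]<k⇒2^n<k*8 n k 3≤n 2^[n∸3]<k = subst (_< k ℕ.* 8) 2^[n∸3]*8≡2^n (NP.*-monoˡ-< 8 2^[n∸3]<k)
  where
  2^[n∸3]*8≡2^n : 2 ^ (n ∸ 3) ℕ.* 8 ≡ 2 ^ n
  2^[n∸3]*8≡2^n = trans (sym (NP.^-distribˡ-+-* 2 (n ∸ 3) 3)) (cong (2 ^_) (NP.m∸n+n≡m 3≤n))

theorem8p4 : (n : ℕ) → 3 ≤ n → (k : ℕ) → 2 ^ (n ∸ 3) < k → k ≤ 2 ^ (n ∸ 2) →
    (h : ℕ) (H : Fin h → Hyperplane n) → IsHypReps n k h H →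
    (i j : Fin h) → i <ᶠ j →
    (m : ℕ) (w : Fin m → SignedPerm n) → IsEReps n k (H i) (H j) m w →
    IsBijectionOnto (_≈⊔_ {n} {k} {H i} {H j} {m} {w}) _∼_
      (Φ₃ {n} {k} {H i} {H j} {m} {w})
      (λ P → InA k (H i) P × InA k (H j) P)
theorem8p4 n 3≤n k 2^[n∸3]<k _ h H (_ , hyp-reps-distinct , _) i j i<j m w (_ , reps-distinct , reps-complete) =
  proj₂ ,
  (λ (s , P , |P|≡k , P⊆) → inter-poly∈A k (H i) (H j) (w s) P |P|≡k P⊆) ,
  (λ { {s , P , |P|≡k , P⊆} {t , Q , |Q|≡k , Q⊆} P∼Q →
         Φ₃-injective (H i) (H j) w Hi≇Hj reps-distinct s t P Q P⊆ Q⊆ (large {P} |P|≡k) (large {Q} |Q|≡k) P∼Q , P∼Q }) ,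
  (λ P (P∈Ai , P∈Aj) → Φ₃-surjective k (H i) (H j) m w reps-complete P P∈Ai P∈Aj)
  where
  Hi≇Hj : ¬ (⟦ H i ⟧ ≅B ⟦ H j ⟧)
  Hi≇Hj = hyp-reps-distinct i j (FP.<⇒≢ i<j)
  large : ∀ {P : Polytope01 n} → numVerts P ≡ k → 2 ^ n < numVerts P ℕ.* 8
  large |P|≡k = subst (λ l → 2 ^ n < l ℕ.* 8) (sym |P|≡k) (2^[n∸3]<k⇒2^n<k*8 n k 3≤n 2^[n∸3]<k)
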